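{- In $\mathsf{AEM}_{\mathsf{pl}}$ extended by the definitions $x\prec aa\leftrightarrow Ax$ and $y\prec\mathfrak{at}_x\leftrightarrow Pyx\land y\prec aa$, the formula $\forall x\,\exists_{zz\preccurlyeq aa}\big(F_{zz}x\land \forall_{yy\preccurlyeq aa}(F_{yy}x\leftrightarrow zz\approx yy)\land\forall y(F_{zz}y\to x=y)\big)$ is provable.
   Context: Language: two-sorted classical logic with individual variables $x,y,z,\dots$ and plural variables $xx,yy,zz,\dots$; identity $=$ between individuals; the predicate $x\prec tt$ ("$x$ is one of $tt$"), individual on the left, plural term on the right. Abbreviations: $tt\preccurlyeq ss := \forall z(z\prec tt\to z\prec ss)\land \exists x(x\prec tt)$; $tt\approx ss := \forall x(x\prec tt\leftrightarrow x\prec ss)$; $\forall_{z\prec tt}\varphi:=\forall z(z\prec tt\to\varphi)$, $\exists_{z\prec tt}\varphi:=\exists z(z\prec tt\land\varphi)$, $\forall_{yy\preccurlyeq tt}\varphi:=\forall yy(yy\preccurlyeq tt\to\varphi)$, $\exists_{yy\preccurlyeq tt}\varphi:=\exists yy(yy\preccurlyeq tt\land\varphi)$. The only non-logical primitive is a binary predicate $P$ on individuals ("is a part of"); $Oxy:=\exists z(Pzx\land Pzy)$. $\mathsf{AEM}_{\mathsf{pl}}$ has axioms (universally closed): $Pxx$; $Pxy\land Pyz\to Pxz$; $Pxy\land Pyx\to x=y$; $\neg Pxy\to\exists z(Pzx\land\neg Ozy)$; the definitions $Ax\leftrightarrow\forall y(Pyx\to x=y)$ and $F_{zz}x\leftrightarrow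 \forall_{z\prec zz}Pzx\land\forall y(Pyx\to\exists_{z\prec zz}Ozy)$ (mereological sum); and the atomicity axiom $\forall x\exists y(Pyx\land Ay)$. The plural constant $aa$ and plural terms $\mathfrak{at}_x$ are introduced by the stated definitions. -}

module Defs where

open import Data.Product using (Σ; Σ-syntax; _×_; _,_)
open import Data.Empty using (⊥)
open import Relation.Nullary using (¬_)
open import Relation.Binary.PropositionalEquality using (_≡_)

-- Two-sorted structures for the language of AEM_pl (Henkin-style semantics):
-- a domain of individuals D, a domain of pluralities Pl, the relation
-- x ≺ tt ("x is one of tt"), and the primitive parthood predicate P.
-- Identity between individuals is interpreted as Agda's _≡_ on D.
record Structure : Set₁ where
  field
    D   : Set
    Pl  : Set
    _≺_ : D → Pl → Set
    P   : D → D → Set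

module Notions (M : Structure) where
  open Structure M

  O : D → D → Set
  O x y = Σ[ z ∈ D ] (P z x × P z y)

  A : D → Set
  A x = ∀ y → P y x → x ≡ y

  F : Pl → D → Set
  F zz x = (∀ z → z ≺ zz → P z x) × (∀ y → P y x → Σ[ z ∈ D ] (z ≺ zz × O z y))

  _≼_ : Pl → Pl → Set
  tt ≼ ss = (∀ z → z ≺ tt → z ≺ ss) × Σ[ x ∈ D ] (x ≺ tt)

  _≈_ : Pl → Pl → Set
  tt ≈ ss = ∀ x → ((x ≺ tt → x ≺ ss) × (x ≺ ss → x ≺ tt))

record Model : Set₁ where
  field
    structure : Structure
  open Structure structure public
  open Notions structure public
  field
    P-refl    : ∀ x → P x x
    P-trans   : ∀ x y z → P x y → P y z → P x z
    P-antisym : ∀ x y → P x y → P y x → x ≡ y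
    strong-supplementation :
      ∀ x y → ¬ P x y → Σ[ z ∈ D ] (P z x × ¬ O z y)
    atomicity : ∀ x → Σ[ y ∈ D ] (P y x × A y)
    aa  : Pl
    at  : D → Pl
    aa-def : ∀ x → ((x ≺ aa → A x) × (A x → x ≺ aa))
    at-def : ∀ x y → ((y ≺ at x → (P y x × y ≺ aa)) × ((P y x × y ≺ aa) → y ≺ at x))

module Submission where

open import Defs
open import Data.Product using (Σ; Σ-syntax; _×_; _,_; proj₁; proj₂)
open import Relation.Binary.PropositionalEquality using (_≡_; subst; sym; trans)
open import Axiom.ExcludedMiddle using (ExcludedMiddle)
open import Level using (0ℓ)
open import Relation.Nullary using (yes; no)
open import Data.Empty using (⊥-elim)

-- The atoms of x, at x, sum to x: every part of x contains an atom, which is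
-- among at x. Conversely, a sum of atoms must contain every atom of x, since
-- an atom overlapping an atom is that atom; and anything of which at x is a
-- sum is x itself, because under excluded middle strong supplementation says
-- that x is part of y as soon as every part of x overlaps y.

module _ (M : Model) where
  open Model M

  ≺aa⇒A : ∀ {a} → a ≺ aa → A a
  ≺aa⇒A {a} = proj₁ (aa-def a)

  A⇒≺at : ∀ {x a} → P a x → A a → a ≺ at x
  A⇒≺at {x} {a} pax Aa = proj₂ (at-def x a) (pax , proj₂ (aa-def a) Aa)

  ≺at⇒P : ∀ {x a} → a ≺ at x → P a x
  ≺at⇒P {x} {a} a≺at = proj₁ (proj₁ (at-def x a) a≺at)

  ≺at⇒≺aa : ∀ {x a} → a ≺ at x → a ≺ aa
  ≺at⇒≺aa {x} {a} a≺at = proj₂ (proj₁ (at-def x a) a≺at)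

  O-sym : ∀ {x y} → O x y → O y x
  O-sym (z , pzx , pzy) = z , pzy , pzx

  P⇒O : ∀ {x y} → P x y → O x y
  P⇒O {x} pxy = x , P-refl x , pxy

  O-monoʳ : ∀ {x y z} → O x y → P y z → O x z
  O-monoʳ {y = y} {z} (u , pux , puy) pyz = u , pux , P-trans u y z puy pyz

  O-atoms⇒≡ : ∀ {a b} → A a → A b → O a b → a ≡ b
  O-atoms⇒≡ {b = b} Aa Ab (u , pua , pub) = trans (Aa u pua) (sym (Ab u pub))

  F-resp-≈ : ∀ {zz yy x} → zz ≈ yy → F zz x → F yy x
  F-resp-≈ zz≈yy (parts , covers) =
      (λ z z≺yy → parts z (proj₂ (zz≈yy z) z≺yy))
    , λ y pyx → let (w , w≺zz , owy) = covers y pyx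
                in w , proj₁ (zz≈yy w) w≺zz , owy

  at≼aa : ∀ x → at x ≼ aa
  at≼aa x = (λ _ → ≺at⇒≺aa) , (let (a , pax , Aa) = atomicity x in a , A⇒≺at pax Aa)

  F-at : ∀ x → F (at x) x
  F-at x = (λ _ → ≺at⇒P) , λ y pyx →
    let (a , pay , Aa) = atomicity y
    in a , A⇒≺at (P-trans a y x pay pyx) Aa , P⇒O pay

  at⊆sum-of-atoms : ∀ {x yy} → yy ≼ aa → F yy x → ∀ a → a ≺ at x → a ≺ yy
  at⊆sum-of-atoms (yy⊆aa , _) (_ , covers) a a≺at =
    let (w , w≺yy , owa) = covers a (≺at⇒P a≺at)
    in subst (_≺ _) (O-atoms⇒≡ (≺aa⇒A (yy⊆aa w w≺yy)) (≺aa⇒A (≺at⇒≺aa a≺at)) owa) w≺yy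

  sum-of-atoms⊆at : ∀ {x yy} → yy ≼ aa → F yy x → ∀ a → a ≺ yy → a ≺ at x
  sum-of-atoms⊆at (yy⊆aa , _) (parts , _) a a≺yy = A⇒≺at (parts a a≺yy) (≺aa⇒A (yy⊆aa a a≺yy))

  sum-of-atoms⇔≈at : ∀ x yy → yy ≼ aa → (F yy x → at x ≈ yy) × (at x ≈ yy → F yy x)
  sum-of-atoms⇔≈at x yy yy≼aa =
      (λ F-yy a → at⊆sum-of-atoms yy≼aa F-yy a , sum-of-atoms⊆at yy≼aa F-yy a)
    , (λ at≈yy → F-resp-≈ at≈yy (F-at x))

  module _ (em : ExcludedMiddle 0ℓ) where

    P-if-parts-overlap : ∀ {x y} → (∀ z → P z x → O z y) → P x y
    P-if-parts-overlap {x} {y} overlaps with em {P x y}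
    ... | yes pxy = pxy
    ... | no ¬pxy = let (z , pzx , ¬ozy) = strong-supplementation x y ¬pxy
                    in ⊥-elim (¬ozy (overlaps z pzx))

    P-sum-of-at : ∀ {x y} → F (at x) y → P x y
    P-sum-of-at {x} (parts , _) = P-if-parts-overlap λ z pzx →
      let (a , paz , Aa) = atomicity z
      in a , paz , parts a (A⇒≺at (P-trans a z x paz pzx) Aa)

    sum-least : ∀ {zz x y} → (∀ z → z ≺ zz → P z x) → F zz y → P y x
    sum-least below (_ , covers) = P-if-parts-overlap λ z pzy →
      let (w , w≺zz , owz) = covers z pzy
      in O-monoʳ (O-sym owz) (below w w≺zz)

    sum-at-unique : ∀ x y → F (at x) y → x ≡ y
    sum-at-unique x y F-at-y =
      P-antisym x y (P-sum-of-at F-at-y) (sum-least (λ _ → ≺at⇒P) F-at-y)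

lemma6 : ExcludedMiddle 0ℓ → (M : Model) → let open Model M in
    ∀ x → Σ[ zz ∈ Pl ] (zz ≼ aa × F zz x
    × (∀ yy → yy ≼ aa → ((F yy x → zz ≈ yy) × (zz ≈ yy → F yy x)))
    × (∀ y → F zz y → x ≡ y))
lemma6 em M x =
  at x , at≼aa M x , F-at M x , sum-of-atoms⇔≈at M x , sum-at-unique M em x
  where open Model M using (at)
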